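{- Let $n\ge 1$ be an integer and let $A_n\subset A_{n+1}$ be the Aztec diamonds of orders $n$ and $n+1$, with nodes, lattice squares, boundary squares, fields of arrows, and the maps $F$ as defined in the context. Let $\mathcal F$ be a field of arrows on $A_{n+1}$ and let $r(\mathcal F)$ denote its number of repelling nodes. (i) If $\mathcal F$ is inward pointing, then there are precisely $2^{r(\mathcal F)}$ domino tilings $\mathcal T$ of $A_n$ with $F(\mathcal T)=\mathcal F$. (ii) If $\mathcal F$ is outward pointing, then there are precisely $2^{r(\mathcal F)}$ domino tilings $\mathcal T$ of $A_{n+1}$ with $F(\mathcal T)=\mathcal F$.
   Context: A domino is a $1\times 2$ (or $2\times 1$) rectangle in the plane whose corners have integer coordinates; a domino tiling of a set $S$ is a covering of $S$ by dominoes with pairwise disjoint interiors. For an integer $m\ge 1$, the Aztec diamond of order $m$ is $A_m=\bigcup\{Q : Q\cap\{(x,y): |x|+|y|<m\}\neq\emptyset\}$, where $Q$ ranges over the closed unit squares $[k,k+1]\times[l,l+1]$, $k,l\in\mathbb Z$. Fix $n\ge1$. A node is a lattice point $(i,j)\in A_{n+1}$ with $i+j\equiv n \pmod 2$; nodes lying in $A_n$ are called interior nodes (the remaining nodes lie on the boundary of $A_{n+1}$). A lattice square is a closed unit square with integer-coordinate corners contained in $A_{n+1}$; a boundary square is a lattice square contained in $A_{n+1}$ but not in $A_n$. Each lattice square has exactly two (diagonally opposite) corners that are nodes, and each interior node is a corner of exactly four lattice squares (its adjacent squares); for a boundary square, exactly one of its two node corners is an interior node. Suppose in each lattice square one draws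 an arrow along the diagonal pointing from one of its node corners to the other. This collection is a field of arrows on $A_{n+1}$ if every interior node $N$ is either attracting (all four adjacent arrows point towards $N$), repelling (all four adjacent arrows point away from $N$), or transient (any two collinear arrows adjacent to $N$, i.e. the arrows in the two pairs of squares meeting only at $N$, point in the same direction). A field of arrows is outward pointing if every arrow in a boundary square points towards its non-interior node corner, and inward pointing if every arrow in a boundary square points towards its interior node corner. Each domino with integer corners has exactly two of its corners that are nodes, and each of its two unit squares contains exactly one of these. For a domino tiling $\mathcal T$ of $A_{n+1}$, $F(\mathcal T)$ is the arrangement of arrows in which, in each lattice square, the arrow points towards the node that is a corner of the domino of $\mathcal T$ containing that square; this is an outward pointing field of arrows. For a domino tiling $\mathcal T$ of $A_n$, $F(\mathcal T)$ is defined by the same rule on the lattice squares of $A_n$, together with arrows pointing towards the interior node in every boundary square; this is an inward pointing field of arrows on $A_{n+1}$. -}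

module Defs where

open import Data.Nat as ℕ using (ℕ; zero; suc; _<_; _<?_; _^_)
open import Data.Integer as ℤ using (ℤ; +_; -[1+_]; _+_; _-_; ∣_∣; 1ℤ)
open import Data.Bool as Bool using (Bool; true; false; not; if_then_else_)
open import Data.Product using (Σ; _×_; _,_; proj₁)
open import Data.Product.Properties using (≡-dec)
open import Data.Sum using (_⊎_)
open import Data.Fin using (Fin)
open import Data.List using (List; length; filter; applyUpTo; cartesianProduct)
open import Relation.Nullary using (¬_; Dec)
open import Relation.Nullary.Decidable using (_×-dec_; _⊎-dec_)
open import Relation.Binary.PropositionalEquality using (_≡_)

-- Lattice points and unit squares.  A unit square [k,k+1]×[l,l+1] is
-- represented by its lower-left corner (k , l).

Point : Set
Point = ℤ × ℤ

Sq : Set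
Sq = ℤ × ℤ

-- distance from 0 to the interval [k, k+1]  (k ≥ 0 ↦ k, k = -(j+1) ↦ j)
dist : ℤ → ℕ
dist (+ k)     = k
dist -[1+ j ]  = j

-- The square (k , l) is one of the squares Q making up A_m, i.e. Q meets
-- the open diamond {|x|+|y| < m}  (min of |x|+|y| on Q is dist k + dist l).
InA : ℕ → Sq → Set
InA m (k , l) = dist k ℕ.+ dist l < m

PointIn : ℕ → Point → Set
PointIn m (i , j) =
  InA m (i , j) ⊎ InA m (i - 1ℤ , j) ⊎ InA m (i , j - 1ℤ) ⊎ InA m (i - 1ℤ , j - 1ℤ)

data Orient : Set where
  hor ver : Orient

-- (hor , k , l) = [k,k+2]×[l,l+1];  (ver , k , l) = [k,k+1]×[l,l+2]
Domino : Set
Domino = Orient × ℤ × ℤ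

Covers : Domino → Sq → Set
Covers (hor , k , l) s = s ≡ (k , l) ⊎ s ≡ (k + 1ℤ , l)
Covers (ver , k , l) s = s ≡ (k , l) ⊎ s ≡ (k , l + 1ℤ)

DominoIn : ℕ → Domino → Set
DominoIn m (hor , k , l) = InA m (k , l) × InA m (k + 1ℤ , l)
DominoIn m (ver , k , l) = InA m (k , l) × InA m (k , l + 1ℤ)

IsCorner : Point → Domino → Set
IsCorner p (hor , k , l) =
  p ≡ (k , l) ⊎ p ≡ (k + 1ℤ + 1ℤ , l) ⊎ p ≡ (k , l + 1ℤ) ⊎ p ≡ (k + 1ℤ + 1ℤ , l + 1ℤ)
IsCorner p (ver , k , l) =
  p ≡ (k , l) ⊎ p ≡ (k + 1ℤ , l) ⊎ p ≡ (k , l + 1ℤ + 1ℤ) ⊎ p ≡ (k + 1ℤ , l + 1ℤ + 1ℤ)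

IsTiling : ℕ → (Domino → Bool) → Set
IsTiling m t =
  (∀ D → t D ≡ true → DominoIn m D) ×
  (∀ s → InA m s → Σ Domino λ D → t D ≡ true × Covers D s) ×
  (∀ s D D′ → t D ≡ true → t D′ ≡ true → Covers D s → Covers D′ s → D ≡ D′)

Tiling : ℕ → Set
Tiling m = Σ (Domino → Bool) (IsTiling m)

_≈T_ : ∀ {m} → Tiling m → Tiling m → Set
T ≈T T′ = ∀ D → proj₁ T D ≡ proj₁ T′ D

CountIs : (m : ℕ) → (Tiling m → Set) → ℕ → Set
CountIs m P k =
  Σ (Fin k → Tiling m) λ e →
    (∀ i → P (e i)) ×
    (∀ i j → e i ≈T e j → i ≡ j) ×
    (∀ T → P T → Σ (Fin k) λ i → e i ≈T T)

evenℕ : ℕ → Bool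
evenℕ zero    = true
evenℕ (suc k) = not (evenℕ k)

evenℤ : ℤ → Bool
evenℤ z = evenℕ ∣ z ∣

nodeParity : ℕ → Point → Bool
nodeParity n (i , j) = evenℤ (i + j - + n)

IsNode : ℕ → Point → Set
IsNode n p = PointIn (suc n) p × nodeParity n p ≡ true

InteriorNode : ℕ → Point → Set
InteriorNode n p = IsNode n p × PointIn n p

BoundarySq : ℕ → Sq → Set
BoundarySq n s = InA (suc n) s × ¬ InA n s

-- the two (diagonally opposite) node corners of a square: upper and lower
upperNode : ℕ → Sq → Point
upperNode n (k , l) = if nodeParity n (k , l) then (k + 1ℤ , l + 1ℤ) else (k , l + 1ℤ)

lowerNode : ℕ → Sq → Point
lowerNode n (k , l) = if nodeParity n (k , l) then (k , l) else (k + 1ℤ , l)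

-- An arrangement assigns to every square s a
-- Bool: true = the diagonal arrow in s points (from lowerNode) to upperNode,
-- false = it points (from upperNode) to lowerNode.  Only the values on the
-- lattice squares of A_{n+1} are relevant.

Arrows : Set
Arrows = Sq → Bool

head : ℕ → Sq → Bool → Point
head n s b = if b then upperNode n s else lowerNode n s

tail : ℕ → Sq → Bool → Point
tail n s b = head n s (not b)

dir : ℕ → Arrows → Sq → ℤ × ℤ
dir n f s with head n s (f s) | tail n s (f s)
... | (a , b) | (c , d) = (a - c , b - d)

sqNE sqNW sqSW sqSE : Point → Sq
sqNE (i , j) = (i , j)
sqNW (i , j) = (i - 1ℤ , j)
sqSW (i , j) = (i - 1ℤ , j - 1ℤ)
sqSE (i , j) = (i , j - 1ℤ)

PointsTo : ℕ → Arrows → Sq → Point → Set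
PointsTo n f s N = head n s (f s) ≡ N

PointsAway : ℕ → Arrows → Sq → Point → Set
PointsAway n f s N = tail n s (f s) ≡ N

Attracting : ℕ → Arrows → Point → Set
Attracting n f N =
  PointsTo n f (sqNE N) N × PointsTo n f (sqNW N) N ×
  PointsTo n f (sqSW N) N × PointsTo n f (sqSE N) N

Repelling : ℕ → Arrows → Point → Set
Repelling n f N =
  PointsAway n f (sqNE N) N × PointsAway n f (sqNW N) N ×
  PointsAway n f (sqSW N) N × PointsAway n f (sqSE N) N

Transient : ℕ → Arrows → Point → Set
Transient n f N = dir n f (sqNE N) ≡ dir n f (sqSW N) × dir n f (sqNW N) ≡ dir n f (sqSE N)

IsField : ℕ → Arrows → Set
IsField n f = ∀ N → InteriorNode n N → Attracting n f N ⊎ Repelling n f N ⊎ Transient n f N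

OutwardPointing : ℕ → Arrows → Set
OutwardPointing n f = ∀ s → BoundarySq n s → ¬ PointIn n (head n s (f s))

InwardPointing : ℕ → Arrows → Set
InwardPointing n f = ∀ s → BoundarySq n s → PointIn n (head n s (f s))

_≟P_ : (p q : Point) → Dec (p ≡ q)
_≟P_ = ≡-dec ℤ._≟_ ℤ._≟_

InA? : ∀ m s → Dec (InA m s)
InA? m (k , l) = (dist k ℕ.+ dist l) <? m

PointIn? : ∀ m p → Dec (PointIn m p)
PointIn? m (i , j) =
  InA? m (i , j) ⊎-dec InA? m (i - 1ℤ , j) ⊎-dec InA? m (i , j - 1ℤ) ⊎-dec InA? m (i - 1ℤ , j - 1ℤ)

InteriorNode? : ∀ n p → Dec (InteriorNode n p)
InteriorNode? n p = (PointIn? (suc n) p ×-dec (nodeParity n p Bool.≟ true)) ×-dec PointIn? n p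

Repelling? : ∀ n f N → Dec (Repelling n f N)
Repelling? n f N =
  (tail n (sqNE N) (f (sqNE N)) ≟P N) ×-dec (tail n (sqNW N) (f (sqNW N)) ≟P N) ×-dec
  (tail n (sqSW N) (f (sqSW N)) ≟P N) ×-dec (tail n (sqSE N) (f (sqSE N)) ≟P N)

range : ℕ → List ℤ
range m = applyUpTo (λ i → + i - + m) (suc (m ℕ.+ m))

-- all lattice points in [-m,m]², which contains every lattice point of A_m
grid : ℕ → List Point
grid m = cartesianProduct (range m) (range m)

repellingCount : ℕ → Arrows → ℕ
repellingCount n f =
  length (filter (λ N → InteriorNode? n N ×-dec Repelling? n f N) (grid (suc n)))

-- The map F.  F(T) = 𝓕 says: in each lattice square s, the arrow of 𝓕
-- points towards the node that is a corner of the domino of T containing s.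

FollowsTiling : ℕ → (m : ℕ) → Tiling m → Arrows → Set
FollowsTiling n m T f =
  ∀ s → InA m s → ∀ D → proj₁ T D ≡ true → Covers D s → IsCorner (head n s (f s)) D

F-big≡ : (n : ℕ) → Tiling (suc n) → Arrows → Set
F-big≡ n T f = FollowsTiling n (suc n) T f

-- T a tiling of A_n:  F(T) = 𝓕  (rule on squares of A_n, and on boundary
-- squares the arrow points towards the interior node)
F-small≡ : (n : ℕ) → Tiling n → Arrows → Set
F-small≡ n T f = FollowsTiling n n T f × InwardPointing n f

module Submission where

-- Every domino has exactly one node at the midpoint of a long
-- side, and the arrows of its two squares leave that node.  So a tiling
-- with arrows f pairs up, at every interior node N, the squares whose arrows
-- leave N: at an attracting node there are none, at a transient node the
-- two outgoing arrows are adjacent and form one domino, and at a repelling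
-- node the four outgoing arrows can be paired horizontally or vertically.

open import Defs
open import Data.Nat as ℕ using (ℕ; zero; suc; _≤_; _^_; _<_; z≤n; s≤s; _∸_)
import Data.Nat.Properties as ℕP
import Data.Integer.Properties as ℤP
open import Data.Integer using (ℤ; +_; -[1+_]; 1ℤ; ∣_∣; _+_; _-_; -_)
open import Algebra.Bundles using (AbelianGroup)
open import Algebra.Properties.Group (AbelianGroup.group ℤP.+-0-abelianGroup) using (identityʳ-unique; ∙-cancelʳ)
open import Data.Integer.Solver using (module +-*-Solver)
open import Data.Bool as Bool using (Bool; true; false; not; if_then_else_)
open import Data.Bool.Properties using (not-involutive; not-¬)
open import Data.Product using (Σ; _×_; _,_; proj₁; proj₂)
open import Data.Empty using (⊥; ⊥-elim)
open import Data.Sum using (_⊎_; inj₁; inj₂)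
open import Relation.Nullary using (¬_; Dec; does; yes; no)
open import Relation.Nullary.Decidable using (map′; _×-dec_; _→-dec_; dec-true; dec-false)
open import Relation.Binary.PropositionalEquality
  using (_≡_; _≢_; _≗_; refl; sym; trans; cong; cong₂; subst; subst₂; module ≡-Reasoning)
open import Function using (_∘_; case_of_)
open import Function.Bundles using (Inverse)
open import Data.Fin using (Fin; zero; suc; combine; funToFin; finToFun)
open import Data.Fin.Properties using (2↔Bool; funToFin-finToFin; finToFun-funToFin)
open import Data.List as List using (List; _∷_; length; filter)
open import Data.List.Membership.Propositional using (_∈_)
open import Data.List.Membership.Propositional.Properties
  using (∈-lookup; ∈-filter⁺; ∈-filter⁻; ∈-applyUpTo⁺; ∈-cartesianProduct⁺)
open import Data.List.Membership.DecPropositional _≟P_ using (_∈?_)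
open import Data.List.Relation.Unary.Any using (here; there; index)
open import Data.List.Relation.Unary.Any.Properties using (lookup-index)
open import Data.List.Relation.Unary.All as All using ()
open import Data.List.Relation.Unary.AllPairs using (_∷_)
open import Data.List.Relation.Unary.Unique.Propositional using (Unique)
open import Data.List.Relation.Unary.Unique.Propositional.Properties
  using (applyUpTo⁺₁; cartesianProduct⁺) renaming (filter⁺ to unique-filter⁺)
open +-*-Solver

does-true : ∀ {A : Set} (a? : Dec A) → does a? ≡ true → A
does-true (yes a) _ = a

opposite-not-both : ∀ {a b} → a ≡ not b → a ≡ true → b ≡ true → ⊥
opposite-not-both {b = true} () refl refl

opposite-true : ∀ {a b} → a ≡ not b → a ≡ false → b ≡ true
opposite-true {b = true}  _  _    = refl
opposite-true {b = false} () refl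

_⇔ᵇ_ : Bool → Bool → Bool
true  ⇔ᵇ b = b
false ⇔ᵇ b = not b

⇔ᵇ-true : ∀ a b → a ⇔ᵇ b ≡ true → a ≡ b
⇔ᵇ-true true  true  _ = refl
⇔ᵇ-true false false _ = refl

⇔ᵇ-comm : ∀ a b → a ⇔ᵇ b ≡ b ⇔ᵇ a
⇔ᵇ-comm true  true  = refl
⇔ᵇ-comm true  false = refl
⇔ᵇ-comm false true  = refl
⇔ᵇ-comm false false = refl

⇔ᵇ-notˡ : ∀ a b → not a ⇔ᵇ b ≡ not (a ⇔ᵇ b)
⇔ᵇ-notˡ true  b = refl
⇔ᵇ-notˡ false b = sym (not-involutive b)

evenℕ-+ : ∀ a b → evenℕ (a ℕ.+ b) ≡ evenℕ a ⇔ᵇ evenℕ b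
evenℕ-+ zero    b = refl
evenℕ-+ (suc a) b = trans (cong not (evenℕ-+ a b)) (sym (⇔ᵇ-notˡ (evenℕ a) (evenℕ b)))

evenℤ-suc : ∀ z → evenℤ (z + 1ℤ) ≡ not (evenℤ z)
evenℤ-suc (+ a)          = trans (evenℕ-+ a 1) (lemma (evenℕ a))
  where lemma : ∀ x → x ⇔ᵇ false ≡ not x
        lemma true  = refl
        lemma false = refl
evenℤ-suc -[1+ zero ]    = refl
evenℤ-suc -[1+ suc a ]   = sym (not-involutive (not (evenℕ a)))

evenℤ-pred : ∀ z → evenℤ (z - 1ℤ) ≡ not (evenℤ z)
evenℤ-pred z = begin
  evenℤ (z - 1ℤ)                 ≡⟨ not-involutive _ ⟨
  not (not (evenℤ (z - 1ℤ)))     ≡⟨ cong not (evenℤ-suc (z - 1ℤ)) ⟨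
  not (evenℤ (z - 1ℤ + 1ℤ))      ≡⟨ cong (not ∘ evenℤ) (solve 1 (λ z → z :- con 1ℤ :+ con 1ℤ := z) refl z) ⟩
  not (evenℤ z)                  ∎
  where open ≡-Reasoning

evenℤ-+ℕ : ∀ z a → evenℤ (z + + a) ≡ evenℕ a ⇔ᵇ evenℤ z
evenℤ-+ℕ z zero    = cong evenℤ (ℤP.+-identityʳ z)
evenℤ-+ℕ z (suc a) = begin
  evenℤ (z + + suc a)            ≡⟨ cong evenℤ (solve 2 (λ z a → z :+ (con 1ℤ :+ a) := z :+ a :+ con 1ℤ) refl z (+ a)) ⟩
  evenℤ (z + + a + 1ℤ)           ≡⟨ evenℤ-suc (z + + a) ⟩
  not (evenℤ (z + + a))          ≡⟨ cong not (evenℤ-+ℕ z a) ⟩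
  not (evenℕ a ⇔ᵇ evenℤ z)       ≡⟨ ⇔ᵇ-notˡ (evenℕ a) (evenℤ z) ⟨
  evenℕ (suc a) ⇔ᵇ evenℤ z       ∎
  where open ≡-Reasoning

evenℤ-+neg : ∀ z a → evenℤ (z + -[1+ a ]) ≡ evenℕ (suc a) ⇔ᵇ evenℤ z
evenℤ-+neg z zero    = evenℤ-pred z
evenℤ-+neg z (suc a) = begin
  evenℤ (z + -[1+ suc a ])             ≡⟨ cong evenℤ step ⟩
  evenℤ (z + -[1+ a ] - 1ℤ)            ≡⟨ evenℤ-pred (z + -[1+ a ]) ⟩
  not (evenℤ (z + -[1+ a ]))           ≡⟨ cong not (evenℤ-+neg z a) ⟩
  not (evenℕ (suc a) ⇔ᵇ evenℤ z)       ≡⟨ ⇔ᵇ-notˡ (evenℕ (suc a)) (evenℤ z) ⟨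
  evenℕ (suc (suc a)) ⇔ᵇ evenℤ z       ∎
  where
    open ≡-Reasoning
    step : z + -[1+ suc a ] ≡ z + -[1+ a ] - 1ℤ
    step = trans (cong (λ k → z + -[1+ suc k ]) (sym (ℕP.+-identityʳ a)))
                 (solve 2 (λ z w → z :+ (w :- con 1ℤ) := z :+ w :- con 1ℤ) refl z -[1+ a ])

evenℤ-+ : ∀ x y → evenℤ (x + y) ≡ evenℤ y ⇔ᵇ evenℤ x
evenℤ-+ x (+ a)    = evenℤ-+ℕ x a
evenℤ-+ x -[1+ a ] = evenℤ-+neg x a

evenℤ-neg : ∀ z → evenℤ (- z) ≡ evenℤ z
evenℤ-neg -[1+ _ ]  = refl
evenℤ-neg (+ zero)  = refl
evenℤ-neg (+ suc _) = refl

node-parity : ∀ n x y → nodeParity n (x , y) ≡ true → evenℕ (∣ x ∣ ℕ.+ ∣ y ∣) ≡ evenℕ n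
node-parity n x y par = begin
  evenℕ (∣ x ∣ ℕ.+ ∣ y ∣)      ≡⟨ evenℕ-+ ∣ x ∣ ∣ y ∣ ⟩
  evenℤ x ⇔ᵇ evenℤ y          ≡⟨ ⇔ᵇ-comm (evenℤ x) (evenℤ y) ⟩
  evenℤ y ⇔ᵇ evenℤ x          ≡⟨ ⇔ᵇ-true (evenℕ n) _ parity ⟨
  evenℕ n                     ∎
  where
    open ≡-Reasoning
    parity : evenℕ n ⇔ᵇ (evenℤ y ⇔ᵇ evenℤ x) ≡ true
    parity = begin
      evenℕ n ⇔ᵇ (evenℤ y ⇔ᵇ evenℤ x)      ≡⟨ cong₂ _⇔ᵇ_ (evenℤ-neg (+ n)) (evenℤ-+ x y) ⟨
      evenℤ (- + n) ⇔ᵇ evenℤ (x + y)       ≡⟨ evenℤ-+ (x + y) (- + n) ⟨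
      nodeParity n (x , y)                 ≡⟨ par ⟩
      true                                 ∎

parity-step : ∀ n x y x′ y′ → x′ + y′ - + n ≡ (x + y - + n) + 1ℤ ⊎ x′ + y′ - + n ≡ (x + y - + n) - 1ℤ →
              nodeParity n (x′ , y′) ≡ not (nodeParity n (x , y))
parity-step n x y x′ y′ (inj₁ e) = trans (cong evenℤ e) (evenℤ-suc (x + y - + n))
parity-step n x y x′ y′ (inj₂ e) = trans (cong evenℤ e) (evenℤ-pred (x + y - + n))

parity-x+ : ∀ n x y → nodeParity n (x + 1ℤ , y) ≡ not (nodeParity n (x , y))
parity-x+ n x y = parity-step n x y (x + 1ℤ) y (inj₁ (solve 3 (λ x y m → x :+ con 1ℤ :+ y :- m := x :+ y :- m :+ con 1ℤ) refl x y (+ n)))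

parity-y+ : ∀ n x y → nodeParity n (x , y + 1ℤ) ≡ not (nodeParity n (x , y))
parity-y+ n x y = parity-step n x y x (y + 1ℤ) (inj₁ (solve 3 (λ x y m → x :+ (y :+ con 1ℤ) :- m := x :+ y :- m :+ con 1ℤ) refl x y (+ n)))

parity-x- : ∀ n x y → nodeParity n (x - 1ℤ , y) ≡ not (nodeParity n (x , y))
parity-x- n x y = parity-step n x y (x - 1ℤ) y (inj₂ (solve 3 (λ x y m → x :- con 1ℤ :+ y :- m := x :+ y :- m :- con 1ℤ) refl x y (+ n)))

parity-y- : ∀ n x y → nodeParity n (x , y - 1ℤ) ≡ not (nodeParity n (x , y))
parity-y- n x y = parity-step n x y x (y - 1ℤ) (inj₂ (solve 3 (λ x y m → x :+ (y :- con 1ℤ) :- m := x :+ y :- m :- con 1ℤ) refl x y (+ n)))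

data Pos : Set where
  NE NW SW SE : Pos

sqAt : Point → Pos → Sq
sqAt N NE = sqNE N
sqAt N NW = sqNW N
sqAt N SW = sqSW N
sqAt N SE = sqSE N

antipode : Pos → Pos
antipode NE = SW
antipode NW = SE
antipode SW = NE
antipode SE = NW

xstep ystep : Pos → ℤ
xstep NE = + 1
xstep NW = -[1+ 0 ]
xstep SW = -[1+ 0 ]
xstep SE = + 1
ystep NE = + 1
ystep NW = + 1
ystep SW = -[1+ 0 ]
ystep SE = -[1+ 0 ]

opp : Point → Pos → Point
opp (i , j) p = (i + xstep p , j + ystep p)

shift≢ : ∀ i d → d ≢ + 0 → i + d ≢ i
shift≢ i d d≢0 e = d≢0 (identityʳ-unique i d e)

pred≢ : ∀ i → i - 1ℤ ≢ i
pred≢ i = shift≢ i -[1+ 0 ] (λ ())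

opp≢ : ∀ N p → opp N p ≢ N
opp≢ (i , j) NE e = shift≢ i (+ 1) (λ ()) (cong proj₁ e)
opp≢ (i , j) NW e = shift≢ i -[1+ 0 ] (λ ()) (cong proj₁ e)
opp≢ (i , j) SW e = shift≢ i -[1+ 0 ] (λ ()) (cong proj₁ e)
opp≢ (i , j) SE e = shift≢ i (+ 1) (λ ()) (cong proj₁ e)

sqAt-injective : ∀ N p q → sqAt N p ≡ sqAt N q → p ≡ q
sqAt-injective N NE NE e = refl
sqAt-injective N NW NW e = refl
sqAt-injective N SW SW e = refl
sqAt-injective N SE SE e = refl
sqAt-injective (i , j) NE NW e = ⊥-elim (pred≢ i (sym (cong proj₁ e)))
sqAt-injective (i , j) NE SW e = ⊥-elim (pred≢ i (sym (cong proj₁ e)))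
sqAt-injective (i , j) NE SE e = ⊥-elim (pred≢ j (sym (cong proj₂ e)))
sqAt-injective (i , j) NW NE e = ⊥-elim (pred≢ i (cong proj₁ e))
sqAt-injective (i , j) NW SW e = ⊥-elim (pred≢ j (sym (cong proj₂ e)))
sqAt-injective (i , j) NW SE e = ⊥-elim (pred≢ i (cong proj₁ e))
sqAt-injective (i , j) SW NE e = ⊥-elim (pred≢ i (cong proj₁ e))
sqAt-injective (i , j) SW NW e = ⊥-elim (pred≢ j (cong proj₂ e))
sqAt-injective (i , j) SW SE e = ⊥-elim (pred≢ i (cong proj₁ e))
sqAt-injective (i , j) SE NE e = ⊥-elim (pred≢ j (cong proj₂ e))
sqAt-injective (i , j) SE NW e = ⊥-elim (pred≢ i (sym (cong proj₁ e)))
sqAt-injective (i , j) SE SW e = ⊥-elim (pred≢ i (sym (cong proj₁ e)))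

-- Arrows seen from a node.  For the arrow b in the p-square of a node,
-- pointsOut p b says whether it points away from the node.

pointsOut : Pos → Bool → Bool
pointsOut NE b = b
pointsOut NW b = b
pointsOut SW b = not b
pointsOut SE b = not b

pred+1 : ∀ i → i - 1ℤ + 1ℤ ≡ i
pred+1 = solve 1 (λ i → i :- con 1ℤ :+ con 1ℤ := i) refl

arrowAt : ∀ n N p b → nodeParity n N ≡ true →
          head n (sqAt N p) b ≡ (if pointsOut p b then opp N p else N) ×
          tail n (sqAt N p) b ≡ (if pointsOut p b then N else opp N p)
arrowAt n (i , j) NE true  par rewrite par = refl , refl
arrowAt n (i , j) NE false par rewrite par = refl , refl
arrowAt n (i , j) NW b par rewrite parity-x- n i j | par | pred+1 i with b
... | true  = refl , refl
... | false = refl , refl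
arrowAt n (i , j) SW b par rewrite parity-x- n i (j - 1ℤ) | parity-y- n i j | par | pred+1 i | pred+1 j with b
... | true  = refl , refl
... | false = refl , refl
arrowAt n (i , j) SE b par rewrite parity-y- n i j | par | pred+1 j with b
... | true  = refl , refl
... | false = refl , refl

module _ (n : ℕ) (f : Arrows) where

  away : Point → Pos → Bool
  away N p = pointsOut p (f (sqAt N p))

  module _ {N : Point} (p : Pos) (par : nodeParity n N ≡ true) where

    away-true : away N p ≡ true →
                tail n (sqAt N p) (f (sqAt N p)) ≡ N × head n (sqAt N p) (f (sqAt N p)) ≡ opp N p
    away-true e with arrowAt n N p (f (sqAt N p)) par
    ... | hd , tl rewrite e = tl , hd

    away-false : away N p ≡ false →
                 head n (sqAt N p) (f (sqAt N p)) ≡ N × tail n (sqAt N p) (f (sqAt N p)) ≡ opp N p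
    away-false e with arrowAt n N p (f (sqAt N p)) par
    ... | hd , tl rewrite e = hd , tl

    tail→away : tail n (sqAt N p) (f (sqAt N p)) ≡ N → away N p ≡ true
    tail→away tl with away N p in e
    ... | true  = refl
    ... | false = ⊥-elim (opp≢ N p (trans (sym (proj₂ (away-false e))) tl))

    head→away : head n (sqAt N p) (f (sqAt N p)) ≡ N → away N p ≡ false
    head→away hd with away N p in e
    ... | false = refl
    ... | true  = ⊥-elim (opp≢ N p (trans (sym (proj₂ (away-true e))) hd))

  dir-x : ∀ N p → nodeParity n N ≡ true →
          proj₁ (dir n f (sqAt N p)) ≡ (if away N p then xstep p else - xstep p)
  dir-x (i , j) p par with away (i , j) p in e
  ... | true  with away-true p par e
  ...   | tl , hd rewrite tl | hd = solve 2 (λ i d → i :+ d :- i := d) refl i (xstep p)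
  dir-x (i , j) p par | false with away-false p par e
  ...   | hd , tl rewrite tl | hd = solve 2 (λ i d → i :- (i :+ d) := :- d) refl i (xstep p)

  collinear : ∀ N p → nodeParity n N ≡ true →
              dir n f (sqAt N p) ≡ dir n f (sqAt N (antipode p)) → away N p ≡ not (away N (antipode p))
  collinear N p par same =
    flipped p (away N p) (away N (antipode p))
      (trans (sym (dir-x N p par)) (trans (cong proj₁ same) (dir-x N (antipode p) par)))
    where
      xstep≢ : ∀ p → xstep p ≢ xstep (antipode p)
      xstep≢ NE ()
      xstep≢ NW ()
      xstep≢ SW ()
      xstep≢ SE ()
      flipped : ∀ p a b → (if a then xstep p else - xstep p) ≡ (if b then xstep (antipode p) else - xstep (antipode p)) →
                a ≡ not b
      flipped p true  false _ = refl
      flipped p false true  _ = refl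
      flipped p true  true  e = ⊥-elim (xstep≢ p e)
      flipped p false false e = ⊥-elim (xstep≢ p (ℤP.neg-injective e))

  Attracts Repels Passes : Point → Set
  Attracts N = ∀ p → away N p ≡ false
  Repels   N = ∀ p → away N p ≡ true
  Passes   N = ∀ p → away N p ≡ not (away N (antipode p))

  passes⇒¬repels : ∀ N → Passes N → ¬ Repels N
  passes⇒¬repels N ps r = opposite-not-both (ps NE) (r NE) (r SW)

  repelling⇒repels : ∀ N → nodeParity n N ≡ true → Repelling n f N → Repels N
  repelling⇒repels N par (ne , nw , sw , se) NE = tail→away NE par ne
  repelling⇒repels N par (ne , nw , sw , se) NW = tail→away NW par nw
  repelling⇒repels N par (ne , nw , sw , se) SW = tail→away SW par sw
  repelling⇒repels N par (ne , nw , sw , se) SE = tail→away SE par se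

  repels⇒repelling : ∀ N → nodeParity n N ≡ true → Repels N → Repelling n f N
  repels⇒repelling N par r =
    out NE , out NW , out SW , out SE
    where out : ∀ p → tail n (sqAt N p) (f (sqAt N p)) ≡ N
          out p = proj₁ (away-true p par (r p))

  classify : IsField n f → ∀ N → InteriorNode n N → Attracts N ⊎ Repels N ⊎ Passes N
  classify isField N int@((_ , par) , _) with isField N int
  ... | inj₁ (ne , nw , sw , se) = inj₁ λ where
          NE → head→away NE par ne
          NW → head→away NW par nw
          SW → head→away SW par sw
          SE → head→away SE par se
  ... | inj₂ (inj₁ rep) = inj₂ (inj₁ (repelling⇒repels N par rep))
  ... | inj₂ (inj₂ (ne-sw , nw-se)) = inj₂ (inj₂ λ where
          NE → collinear N NE par ne-sw
          NW → collinear N NW par nw-se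
          SW → collinear N SW par (sym ne-sw)
          SE → collinear N SE par (sym nw-se))

-- Dominoes around a node.  Every domino has exactly one node at the
-- midpoint of one of its long sides; seen from that node it covers one of
-- four pairs of adjacent squares.

data Pair : Set where
  top bot lft rgt : Pair

first second : Pair → Pos
first  top = NW
first  bot = SW
first  lft = SW
first  rgt = SE
second top = NE
second bot = SE
second lft = NW
second rgt = NE

_∈ₚ_ : Pos → Pair → Set
q ∈ₚ pr = q ≡ first pr ⊎ q ≡ second pr

both : ∀ {P : Pos → Set} pr → P (first pr) → P (second pr) → ∀ q → q ∈ₚ pr → P q
both pr p₁ p₂ q (inj₁ refl) = p₁
both pr p₁ p₂ q (inj₂ refl) = p₂

horizontal : Pair → Bool
horizontal top = true
horizontal bot = true
horizontal lft = false
horizontal rgt = false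

domAt : Point → Pair → Domino
domAt (i , j) top = (hor , i - 1ℤ , j)
domAt (i , j) bot = (hor , i - 1ℤ , j - 1ℤ)
domAt (i , j) lft = (ver , i - 1ℤ , j - 1ℤ)
domAt (i , j) rgt = (ver , i , j - 1ℤ)

anchor : ℕ → Domino → Point × Pair
anchor n (hor , k , l) = if nodeParity n (k , l) then ((k + 1ℤ , l + 1ℤ) , bot) else ((k + 1ℤ , l) , top)
anchor n (ver , k , l) = if nodeParity n (k , l) then ((k + 1ℤ , l + 1ℤ) , lft) else ((k , l + 1ℤ) , rgt)

+1-1 : ∀ i → i + 1ℤ - 1ℤ ≡ i
+1-1 = solve 1 (λ i → i :+ con 1ℤ :- con 1ℤ := i) refl

domAt-anchor : ∀ n D → domAt (proj₁ (anchor n D)) (proj₂ (anchor n D)) ≡ D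
domAt-anchor n (hor , k , l) with nodeParity n (k , l)
... | true  rewrite +1-1 k | +1-1 l = refl
... | false rewrite +1-1 k = refl
domAt-anchor n (ver , k , l) with nodeParity n (k , l)
... | true  rewrite +1-1 k | +1-1 l = refl
... | false rewrite +1-1 l = refl

anchor-domAt : ∀ n N pr → nodeParity n N ≡ true → anchor n (domAt N pr) ≡ (N , pr)
anchor-domAt n (i , j) top par rewrite parity-x- n i j | par | pred+1 i = refl
anchor-domAt n (i , j) bot par rewrite parity-x- n i (j - 1ℤ) | parity-y- n i j | par | pred+1 i | pred+1 j = refl
anchor-domAt n (i , j) lft par rewrite parity-x- n i (j - 1ℤ) | parity-y- n i j | par | pred+1 i | pred+1 j = refl
anchor-domAt n (i , j) rgt par rewrite parity-y- n i j | par | pred+1 j = refl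

parity-diag : ∀ n k l → nodeParity n (k + 1ℤ , l + 1ℤ) ≡ nodeParity n (k , l)
parity-diag n k l = begin
  nodeParity n (k + 1ℤ , l + 1ℤ)        ≡⟨ parity-y+ n (k + 1ℤ) l ⟩
  not (nodeParity n (k + 1ℤ , l))       ≡⟨ cong not (parity-x+ n k l) ⟩
  not (not (nodeParity n (k , l)))      ≡⟨ not-involutive _ ⟩
  nodeParity n (k , l)                  ∎
  where open ≡-Reasoning

anchor-node : ∀ n D → nodeParity n (proj₁ (anchor n D)) ≡ true
anchor-node n (hor , k , l) with nodeParity n (k , l) in e
... | true  = trans (parity-diag n k l) e
... | false = trans (parity-x+ n k l) (cong not e)
anchor-node n (ver , k , l) with nodeParity n (k , l) in e
... | true  = trans (parity-diag n k l) e
... | false = trans (parity-y+ n k l) (cong not e)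

covered-square : ∀ N pr s → Covers (domAt N pr) s → Σ Pos λ q → q ∈ₚ pr × s ≡ sqAt N q
covered-square (i , j) top s (inj₁ e) = NW , inj₁ refl , e
covered-square (i , j) top s (inj₂ e) = NE , inj₂ refl , trans e (cong (_, j) (pred+1 i))
covered-square (i , j) bot s (inj₁ e) = SW , inj₁ refl , e
covered-square (i , j) bot s (inj₂ e) = SE , inj₂ refl , trans e (cong (_, j - 1ℤ) (pred+1 i))
covered-square (i , j) lft s (inj₁ e) = SW , inj₁ refl , e
covered-square (i , j) lft s (inj₂ e) = NW , inj₂ refl , trans e (cong (i - 1ℤ ,_) (pred+1 j))
covered-square (i , j) rgt s (inj₁ e) = SE , inj₁ refl , e
covered-square (i , j) rgt s (inj₂ e) = NE , inj₂ refl , trans e (cong (i ,_) (pred+1 j))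

covers-pair : ∀ N pr q → q ∈ₚ pr → Covers (domAt N pr) (sqAt N q)
covers-pair (i , j) top _ (inj₁ refl) = inj₁ refl
covers-pair (i , j) bot _ (inj₁ refl) = inj₁ refl
covers-pair (i , j) lft _ (inj₁ refl) = inj₁ refl
covers-pair (i , j) rgt _ (inj₁ refl) = inj₁ refl
covers-pair (i , j) top _ (inj₂ refl) = inj₂ (cong (_, j) (sym (pred+1 i)))
covers-pair (i , j) bot _ (inj₂ refl) = inj₂ (cong (_, j - 1ℤ) (sym (pred+1 i)))
covers-pair (i , j) lft _ (inj₂ refl) = inj₂ (cong (i - 1ℤ ,_) (sym (pred+1 j)))
covers-pair (i , j) rgt _ (inj₂ refl) = inj₂ (cong (i ,_) (sym (pred+1 j)))

domAt-in : ∀ m N pr → (∀ q → q ∈ₚ pr → InA m (sqAt N q)) → DominoIn m (domAt N pr)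
domAt-in m (i , j) top h = h NW (inj₁ refl) , subst (λ t → InA m (t , j)) (sym (pred+1 i)) (h NE (inj₂ refl))
domAt-in m (i , j) bot h = h SW (inj₁ refl) , subst (λ t → InA m (t , j - 1ℤ)) (sym (pred+1 i)) (h SE (inj₂ refl))
domAt-in m (i , j) lft h = h SW (inj₁ refl) , subst (λ t → InA m (i - 1ℤ , t)) (sym (pred+1 j)) (h NW (inj₂ refl))
domAt-in m (i , j) rgt h = h SE (inj₁ refl) , subst (λ t → InA m (i , t)) (sym (pred+1 j)) (h NE (inj₂ refl))

in-domAt : ∀ m N pr → DominoIn m (domAt N pr) → ∀ q → q ∈ₚ pr → InA m (sqAt N q)
in-domAt m (i , j) top (a , b) = both top a (subst (λ t → InA m (t , j)) (pred+1 i) b)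
in-domAt m (i , j) bot (a , b) = both bot a (subst (λ t → InA m (t , j - 1ℤ)) (pred+1 i) b)
in-domAt m (i , j) lft (a , b) = both lft a (subst (λ t → InA m (i - 1ℤ , t)) (pred+1 j) b)
in-domAt m (i , j) rgt (a , b) = both rgt a (subst (λ t → InA m (i , t)) (pred+1 j) b)

corner-column : ∀ {x y k l} → IsCorner (x , y) (hor , k , l) → x ≡ k ⊎ x ≡ k + 1ℤ + 1ℤ
corner-column (inj₁ refl)               = inj₁ refl
corner-column (inj₂ (inj₁ refl))        = inj₂ refl
corner-column (inj₂ (inj₂ (inj₁ refl))) = inj₁ refl
corner-column (inj₂ (inj₂ (inj₂ refl))) = inj₂ refl

corner-row : ∀ {x y k l} → IsCorner (x , y) (ver , k , l) → y ≡ l ⊎ y ≡ l + 1ℤ + 1ℤ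
corner-row (inj₁ refl)               = inj₁ refl
corner-row (inj₂ (inj₁ refl))        = inj₁ refl
corner-row (inj₂ (inj₂ (inj₁ refl))) = inj₂ refl
corner-row (inj₂ (inj₂ (inj₂ refl))) = inj₂ refl

pred+2 : ∀ i → i + 1ℤ ≡ i - 1ℤ + 1ℤ + 1ℤ
pred+2 = solve 1 (λ i → i :+ con 1ℤ := i :- con 1ℤ :+ con 1ℤ :+ con 1ℤ) refl

not-adjacent : ∀ i → ¬ (i ≡ i - 1ℤ ⊎ i ≡ i - 1ℤ + 1ℤ + 1ℤ)
not-adjacent i (inj₁ e) = pred≢ i (sym e)
not-adjacent i (inj₂ e) = shift≢ i (+ 1) (λ ())
  (trans (pred+2 i) (sym e))

anchor-not-corner : ∀ N pr → ¬ IsCorner N (domAt N pr)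
anchor-not-corner (i , j) top c = not-adjacent i (corner-column c)
anchor-not-corner (i , j) bot c = not-adjacent i (corner-column c)
anchor-not-corner (i , j) lft c = not-adjacent j (corner-row c)
anchor-not-corner (i , j) rgt c = not-adjacent j (corner-row c)

opp-corner : ∀ N pr q → q ∈ₚ pr → IsCorner (opp N q) (domAt N pr)
opp-corner (i , j) top _ (inj₁ refl) = inj₂ (inj₂ (inj₁ refl))
opp-corner (i , j) bot _ (inj₁ refl) = inj₁ refl
opp-corner (i , j) lft _ (inj₁ refl) = inj₁ refl
opp-corner (i , j) rgt _ (inj₁ refl) = inj₂ (inj₁ refl)
opp-corner (i , j) top _ (inj₂ refl) = inj₂ (inj₂ (inj₂ (cong (_, j + 1ℤ) (pred+2 i))))
opp-corner (i , j) bot _ (inj₂ refl) = inj₂ (inj₁ (cong (_, j - 1ℤ) (pred+2 i)))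
opp-corner (i , j) lft _ (inj₂ refl) = inj₂ (inj₂ (inj₁ (cong (i - 1ℤ ,_) (pred+2 j))))
opp-corner (i , j) rgt _ (inj₂ refl) = inj₂ (inj₂ (inj₂ (cong (i + 1ℤ ,_) (pred+2 j))))

hflip vflip : Pos → Pos
hflip NE = NW
hflip NW = NE
hflip SW = SE
hflip SE = SW
vflip NE = SE
vflip NW = SW
vflip SW = NW
vflip SE = NE

hpair vpair : Pos → Pair
hpair NE = top
hpair NW = top
hpair SW = bot
hpair SE = bot
vpair NE = rgt
vpair NW = lft
vpair SW = lft
vpair SE = rgt

∈-hpair : ∀ q → q ∈ₚ hpair q × hflip q ∈ₚ hpair q
∈-hpair NE = inj₂ refl , inj₁ refl
∈-hpair NW = inj₁ refl , inj₂ refl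
∈-hpair SW = inj₁ refl , inj₂ refl
∈-hpair SE = inj₂ refl , inj₁ refl

∈-vpair : ∀ q → q ∈ₚ vpair q × vflip q ∈ₚ vpair q
∈-vpair NE = inj₂ refl , inj₁ refl
∈-vpair NW = inj₂ refl , inj₁ refl
∈-vpair SW = inj₁ refl , inj₂ refl
∈-vpair SE = inj₁ refl , inj₂ refl

hpair-horizontal : ∀ q → horizontal (hpair q) ≡ true
hpair-horizontal NE = refl
hpair-horizontal NW = refl
hpair-horizontal SW = refl
hpair-horizontal SE = refl

vpair-vertical : ∀ q → horizontal (vpair q) ≡ false
vpair-vertical NE = refl
vpair-vertical NW = refl
vpair-vertical SW = refl
vpair-vertical SE = refl

vflip-antipode : ∀ q → vflip q ≡ antipode (hflip q)
vflip-antipode NE = refl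
vflip-antipode NW = refl
vflip-antipode SW = refl
vflip-antipode SE = refl

pair-through : ∀ q pr → q ∈ₚ pr → pr ≡ hpair q ⊎ pr ≡ vpair q
pair-through _ top (inj₁ refl) = inj₁ refl
pair-through _ top (inj₂ refl) = inj₁ refl
pair-through _ bot (inj₁ refl) = inj₁ refl
pair-through _ bot (inj₂ refl) = inj₁ refl
pair-through _ lft (inj₁ refl) = inj₂ refl
pair-through _ lft (inj₂ refl) = inj₂ refl
pair-through _ rgt (inj₁ refl) = inj₂ refl
pair-through _ rgt (inj₂ refl) = inj₂ refl

hpair-squares : ∀ q r → r ∈ₚ hpair q → r ≡ q ⊎ r ≡ hflip q
hpair-squares NE _ (inj₁ refl) = inj₂ refl
hpair-squares NE _ (inj₂ refl) = inj₁ refl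
hpair-squares NW _ (inj₁ refl) = inj₁ refl
hpair-squares NW _ (inj₂ refl) = inj₂ refl
hpair-squares SW _ (inj₁ refl) = inj₁ refl
hpair-squares SW _ (inj₂ refl) = inj₂ refl
hpair-squares SE _ (inj₁ refl) = inj₂ refl
hpair-squares SE _ (inj₂ refl) = inj₁ refl

vpair-squares : ∀ q r → r ∈ₚ vpair q → r ≡ q ⊎ r ≡ vflip q
vpair-squares NE _ (inj₁ refl) = inj₂ refl
vpair-squares NE _ (inj₂ refl) = inj₁ refl
vpair-squares NW _ (inj₁ refl) = inj₂ refl
vpair-squares NW _ (inj₂ refl) = inj₁ refl
vpair-squares SW _ (inj₁ refl) = inj₁ refl
vpair-squares SW _ (inj₂ refl) = inj₂ refl
vpair-squares SE _ (inj₁ refl) = inj₁ refl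
vpair-squares SE _ (inj₂ refl) = inj₂ refl

crossing : ∀ h v → horizontal h ≡ true → horizontal v ≡ false → Σ Pos λ q → q ∈ₚ h × q ∈ₚ v
crossing top lft _ _ = NW , inj₁ refl , inj₂ refl
crossing top rgt _ _ = NE , inj₂ refl , inj₂ refl
crossing bot lft _ _ = SW , inj₁ refl , inj₁ refl
crossing bot rgt _ _ = SE , inj₂ refl , inj₁ refl

corner-nodes : ∀ n s → nodeParity n (upperNode n s) ≡ true × nodeParity n (lowerNode n s) ≡ true
corner-nodes n (k , l) with nodeParity n (k , l) in e
... | true  = trans (parity-diag n k l) e , e
... | false = trans (parity-y+ n k l) (cong not e) , trans (parity-x+ n k l) (cong not e)

tail-node : ∀ n s b → nodeParity n (tail n s b) ≡ true
tail-node n s true  = proj₂ (corner-nodes n s)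
tail-node n s false = proj₁ (corner-nodes n s)

square-of-tail : ∀ n f s → Σ Pos λ q → sqAt (tail n s (f s)) q ≡ s × away n f (tail n s (f s)) q ≡ true
square-of-tail n f s with position n s (f s)
  where
    position : ∀ n s b → Σ Pos λ q → sqAt (tail n s b) q ≡ s
    position n (k , l) b with nodeParity n (k , l) | b
    ... | true  | true  = NE , refl
    ... | true  | false = SW , cong₂ _,_ (+1-1 k) (+1-1 l)
    ... | false | true  = NW , cong (_, l) (+1-1 k)
    ... | false | false = SE , cong (k ,_) (+1-1 l)
... | q , e = q , e , tail→away n f q (tail-node n s (f s)) (subst (λ t → tail n t (f t) ≡ tail n s (f s)) (sym e) refl)

index-lookup : ∀ {xs : List Point} {x} → Unique xs → (x∈ : x ∈ xs) → ∀ k → List.lookup xs k ≡ x → index x∈ ≡ k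
index-lookup _              (here _)    zero    _ = refl
index-lookup (x∉ ∷ _)       (here x≡y)  (suc k) e = ⊥-elim (All.lookup x∉ (∈-lookup k) (sym (trans e x≡y)))
index-lookup (y∉ ∷ _)       (there x∈)  zero    e = ⊥-elim (All.lookup y∉ (subst (_∈ _) (sym e) x∈) refl)
index-lookup (_ ∷ unique)   (there x∈)  (suc k) e = cong suc (index-lookup unique x∈ k e)

bit : Fin 2 → Bool
bit = Inverse.to 2↔Bool

bit-injective : ∀ {x y} → bit x ≡ bit y → x ≡ y
bit-injective {x} {y} e = begin
  x                                  ≡⟨ Inverse.strictlyInverseʳ 2↔Bool x ⟨
  Inverse.from 2↔Bool (bit x)        ≡⟨ cong (Inverse.from 2↔Bool) e ⟩
  Inverse.from 2↔Bool (bit y)        ≡⟨ Inverse.strictlyInverseʳ 2↔Bool y ⟩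
  y                                  ∎
  where open ≡-Reasoning

funToFin-cong : ∀ {r k} {g h : Fin r → Fin k} → g ≗ h → funToFin g ≡ funToFin h
funToFin-cong {zero}  _   = refl
funToFin-cong {suc r} g≗h = cong₂ combine (g≗h zero) (funToFin-cong (g≗h ∘ suc))

module Choices (L : List Point) (unique : Unique L) where

  r : ℕ
  r = length L

  choice : Fin (2 ^ r) → Point → Bool
  choice i N with N ∈? L
  ... | yes N∈ = bit (finToFun {2} {r} i (index N∈))
  ... | no  _  = false

  choice-lookup : ∀ i k → choice i (List.lookup L k) ≡ bit (finToFun {2} {r} i k)
  choice-lookup i k with List.lookup L k ∈? L
  ... | yes k∈ = cong (bit ∘ finToFun {2} {r} i) (index-lookup unique k∈ k refl)
  ... | no  k∉ = ⊥-elim (k∉ (∈-lookup k))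

  choice-injective : ∀ i j → (∀ k → choice i (List.lookup L k) ≡ choice j (List.lookup L k)) → i ≡ j
  choice-injective i j same = begin
    i                          ≡⟨ funToFin-finToFin {r} {2} i ⟨
    funToFin {r} {2} (finToFun {2} {r} i)      ≡⟨ funToFin-cong (λ k → bit-injective
                                    (trans (sym (choice-lookup i k)) (trans (same k) (choice-lookup j k)))) ⟩
    funToFin {r} {2} (finToFun {2} {r} j)      ≡⟨ funToFin-finToFin {r} {2} j ⟩
    j                          ∎
    where open ≡-Reasoning

  choice-onto : ∀ (g : Point → Bool) → Σ (Fin (2 ^ r)) λ i → ∀ N → N ∈ L → choice i N ≡ g N
  choice-onto g = funToFin v , agrees
    where
      v : Fin r → Fin 2
      v k = Inverse.from 2↔Bool (g (List.lookup L k))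
      agrees : ∀ N → N ∈ L → choice (funToFin v) N ≡ g N
      agrees N N∈L with N ∈? L
      ... | no  N∉ = ⊥-elim (N∉ N∈L)
      ... | yes N∈ = begin
        bit (finToFun {2} {r} (funToFin v) (index N∈))  ≡⟨ cong bit (finToFun-funToFin v (index N∈)) ⟩
        bit (v (index N∈))                              ≡⟨ Inverse.strictlyInverseˡ 2↔Bool _ ⟩
        g (List.lookup L (index N∈))                    ≡⟨ cong g (lookup-index N∈) ⟨
        g N                                             ∎
        where open ≡-Reasoning

-- Given a choice c of an orientation (true = horizontal) at every node,
-- pair the outgoing arrows of each interior node into dominoes: at a
-- repelling node in the orientation c, elsewhere in the only possible way.
-- These dominoes form a tiling whose arrows are f, and every tiling with
-- arrows f arises in this way from its orientations at the repelling nodes.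

module Construction (n m : ℕ) (f : Arrows) (isField : IsField n f)
  (tail-interior : ∀ s → InA m s → InteriorNode n (tail n s (f s)))
  (outward-inside : ∀ N → InteriorNode n N → ∀ p → away n f N p ≡ true → InA m (sqAt N p)) where

  nodeOf : Domino → Point
  nodeOf D = proj₁ (anchor n D)

  pairOf : Domino → Pair
  pairOf D = proj₂ (anchor n D)

  domAt-node : ∀ D → D ≡ domAt (nodeOf D) (pairOf D)
  domAt-node D = sym (domAt-anchor n D)

  record Selected (c : Point → Bool) (N : Point) (pr : Pair) : Set where
    field
      inside   : ∀ q → q ∈ₚ pr → InA m (sqAt N q)
      outward  : ∀ q → q ∈ₚ pr → away n f N q ≡ true
      oriented : Repels n f N → horizontal pr ≡ c N

  repels? : ∀ N → Dec (Repels n f N)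
  repels? N = map′ (λ (ne , nw , sw , se) → λ { NE → ne ; NW → nw ; SW → sw ; SE → se })
                   (λ r → r NE , r NW , r SW , r SE)
                   (out NE ×-dec out NW ×-dec out SW ×-dec out SE)
    where out : ∀ p → Dec (away n f N p ≡ true)
          out p = away n f N p Bool.≟ true

  selected? : ∀ c N pr → Dec (Selected c N pr)
  selected? c N pr =
    map′ (λ (in₁ , in₂ , out₁ , out₂ , or) → record { inside = both pr in₁ in₂ ; outward = both pr out₁ out₂ ; oriented = or })
         (λ s → let open Selected s in
                inside _ (inj₁ refl) , inside _ (inj₂ refl) , outward _ (inj₁ refl) , outward _ (inj₂ refl) , oriented)
         (InA? m (sqAt N (first pr)) ×-dec InA? m (sqAt N (second pr)) ×-dec
          (away n f N (first pr) Bool.≟ true) ×-dec (away n f N (second pr) Bool.≟ true) ×-dec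
          (repels? N →-dec (horizontal pr Bool.≟ c N)))

  chosen : (Point → Bool) → Domino → Bool
  chosen c D = does (selected? c (nodeOf D) (pairOf D))

  module _ (c : Point → Bool) {N : Point} (int : InteriorNode n N) where

    select : ∀ pr → (∀ q → q ∈ₚ pr → away n f N q ≡ true) → (Repels n f N → horizontal pr ≡ c N) → Selected c N pr
    select pr out or = record
      { inside = λ q q∈ → outward-inside N int q (out q q∈) ; outward = out ; oriented = or }

    either : ∀ {q q′ r} → away n f N q ≡ true → away n f N q′ ≡ true → r ≡ q ⊎ r ≡ q′ → away n f N r ≡ true
    either out _ (inj₁ refl) = out
    either _ out (inj₂ refl) = out

    selection-exists : ∀ q → away n f N q ≡ true → Σ Pair λ pr → q ∈ₚ pr × Selected c N pr
    selection-exists q out with classify n f isField N int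
    ... | inj₁ att = case trans (sym out) (att q) of λ ()
    ... | inj₂ (inj₁ rep) with c N in e
    ...   | true  = hpair q , proj₁ (∈-hpair q) , select (hpair q) (λ r _ → rep r) (λ _ → trans (hpair-horizontal q) (sym e))
    ...   | false = vpair q , proj₁ (∈-vpair q) , select (vpair q) (λ r _ → rep r) (λ _ → trans (vpair-vertical q) (sym e))
    selection-exists q out | inj₂ (inj₂ ps) with away n f N (hflip q) in e
    ... | true  = hpair q , proj₁ (∈-hpair q) ,
                  select (hpair q) (λ r r∈ → either out e (hpair-squares q r r∈))
                                   (⊥-elim ∘ passes⇒¬repels n f N ps)
    ... | false = vpair q , proj₁ (∈-vpair q) ,
                  select (vpair q) (λ r r∈ → either out vflip-out (vpair-squares q r r∈))
                                   (⊥-elim ∘ passes⇒¬repels n f N ps)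
      where
        vflip-out : away n f N (vflip q) ≡ true
        vflip-out rewrite vflip-antipode q = opposite-true (ps (hflip q)) e

    no-cross : ∀ q → Selected c N (hpair q) → Selected c N (vpair q) → ⊥
    no-cross q sh sv with classify n f isField N int
    ... | inj₁ att = case trans (sym (Selected.outward sh q (proj₁ (∈-hpair q)))) (att q) of λ ()
    ... | inj₂ (inj₁ rep) = case trans (trans (sym (hpair-horizontal q)) (Selected.oriented sh rep))
                                       (trans (sym (Selected.oriented sv rep)) (vpair-vertical q)) of λ ()
    ... | inj₂ (inj₂ ps) = opposite-not-both (ps (hflip q))
                             (Selected.outward sh (hflip q) (proj₂ (∈-hpair q)))
                             (subst (λ r → away n f N r ≡ true) (vflip-antipode q) (Selected.outward sv (vflip q) (proj₂ (∈-vpair q))))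

    selection-unique : ∀ q pr pr′ → q ∈ₚ pr → q ∈ₚ pr′ → Selected c N pr → Selected c N pr′ → pr ≡ pr′
    selection-unique q pr pr′ q∈ q∈′ s s′ with pair-through q pr q∈ | pair-through q pr′ q∈′
    ... | inj₁ refl | inj₁ refl = refl
    ... | inj₂ refl | inj₂ refl = refl
    ... | inj₁ refl | inj₂ refl = ⊥-elim (no-cross q s s′)
    ... | inj₂ refl | inj₁ refl = ⊥-elim (no-cross q s′ s)

  chosen-selected : ∀ c D → chosen c D ≡ true → Selected c (nodeOf D) (pairOf D)
  chosen-selected c D = does-true (selected? c (nodeOf D) (pairOf D))

  chosen-domAt : ∀ c N pr → nodeParity n N ≡ true → chosen c (domAt N pr) ≡ does (selected? c N pr)
  chosen-domAt c N pr par = cong (λ a → does (selected? c (proj₁ a) (proj₂ a))) (anchor-domAt n N pr par)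

  Outward : Domino → Set
  Outward D = ∀ q → q ∈ₚ pairOf D → away n f (nodeOf D) q ≡ true

  record Leaves (D : Domino) (s : Sq) : Set where
    field
      pos       : Pos
      pos∈      : pos ∈ₚ pairOf D
      at        : s ≡ sqAt (nodeOf D) pos
      from      : tail n s (f s) ≡ nodeOf D
      to-corner : IsCorner (head n s (f s)) D

  outward-interior : ∀ D → Outward D → DominoIn m D → InteriorNode n (nodeOf D)
  outward-interior D out within =
    subst (InteriorNode n) (proj₁ (away-true n f q (anchor-node n D) (out q (inj₁ refl))))
      (tail-interior (sqAt (nodeOf D) q)
        (in-domAt m (nodeOf D) (pairOf D) (subst (DominoIn m) (domAt-node D) within) q (inj₁ refl)))
    where q = first (pairOf D)

  leaves : ∀ D s → Outward D → Covers D s → Leaves D s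
  leaves D s out cv with covered-square (nodeOf D) (pairOf D) s (subst (λ X → Covers X s) (domAt-node D) cv)
  ... | q , q∈ , refl = record
    { pos = q ; pos∈ = q∈ ; at = refl ; from = tl
    ; to-corner = subst (IsCorner (head n s (f s))) (sym (domAt-node D))
                    (subst (λ h → IsCorner h (domAt (nodeOf D) (pairOf D))) (sym hd) (opp-corner (nodeOf D) (pairOf D) q q∈)) }
    where
      tl = proj₁ (away-true n f q (anchor-node n D) (out q q∈))
      hd = proj₂ (away-true n f q (anchor-node n D) (out q q∈))

  module _ (c : Point → Bool) where

    chosen-outward : ∀ D → chosen c D ≡ true → Outward D
    chosen-outward D e = Selected.outward (chosen-selected c D e)

    chosen-within : ∀ D → chosen c D ≡ true → DominoIn m D
    chosen-within D e = subst (DominoIn m) (sym (domAt-node D))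
                          (domAt-in m (nodeOf D) (pairOf D) (Selected.inside (chosen-selected c D e)))

    chosen-cover : ∀ s → InA m s → Σ Domino λ D → chosen c D ≡ true × Covers D s
    chosen-cover s s∈ with square-of-tail n f s
    ... | q , at , out with selection-exists c (tail-interior s s∈) q out
    ...   | pr , q∈ , sel = domAt N pr , trans (chosen-domAt c N pr (tail-node n s (f s))) (dec-true (selected? c N pr) sel)
                          , subst (Covers (domAt N pr)) at (covers-pair N pr q q∈)
      where N = tail n s (f s)

    same-selection : ∀ {N N′ pr pr′ q q′} → N ≡ N′ → sqAt N q ≡ sqAt N′ q′ → InteriorNode n N →
                     q ∈ₚ pr → q′ ∈ₚ pr′ → Selected c N pr → Selected c N′ pr′ → pr ≡ pr′
    same-selection {N} {q = q} {q′} refl e int q∈ q∈′ s s′ with sqAt-injective N q q′ e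
    ... | refl = selection-unique c int q _ _ q∈ q∈′ s s′

    chosen-disjoint : ∀ s D D′ → chosen c D ≡ true → chosen c D′ ≡ true → Covers D s → Covers D′ s → D ≡ D′
    chosen-disjoint s D D′ e e′ cv cv′ = begin
      D                               ≡⟨ domAt-node D ⟩
      domAt (nodeOf D) (pairOf D)     ≡⟨ cong₂ domAt same-node same-pair ⟩
      domAt (nodeOf D′) (pairOf D′)   ≡⟨ domAt-node D′ ⟨
      D′                              ∎
      where
        open ≡-Reasoning
        l  = leaves D s (chosen-outward D e) cv
        l′ = leaves D′ s (chosen-outward D′ e′) cv′
        open Leaves l
        open Leaves l′ renaming (pos to pos′; pos∈ to pos∈′; at to at′; from to from′)
        same-node : nodeOf D ≡ nodeOf D′
        same-node = trans (sym from) from′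
        same-pair : pairOf D ≡ pairOf D′
        same-pair = same-selection same-node (trans (sym at) at′)
                      (outward-interior D (chosen-outward D e) (chosen-within D e)) pos∈ pos∈′
                      (chosen-selected c D e) (chosen-selected c D′ e′)

    chosen-tiling : Tiling m
    chosen-tiling = chosen c , chosen-within , chosen-cover , chosen-disjoint

    chosen-follows : FollowsTiling n m chosen-tiling f
    chosen-follows s _ D e cv = Leaves.to-corner (leaves D s (chosen-outward D e) cv)

  -- At a repelling node the tiling contains the top domino iff the choice is horizontal;
  -- hence different choices at repelling nodes give different tilings.
  chosen-top : ∀ c N → InteriorNode n N → Repels n f N → chosen c (domAt N top) ≡ c N
  chosen-top c N int@((_ , par) , _) rep = trans (chosen-domAt c N top par) (decided (c N) refl)
    where
      decided : ∀ b → c N ≡ b → does (selected? c N top) ≡ b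
      decided true  e = dec-true (selected? c N top) (select c int top (λ q _ → rep q) (λ _ → sym e))
      decided false e = dec-false (selected? c N top) (λ s → case trans (Selected.oriented s rep) e of λ ())

  chosen-injective : ∀ c c′ → chosen c ≗ chosen c′ → ∀ N → InteriorNode n N → Repels n f N → c N ≡ c′ N
  chosen-injective c c′ same N int rep =
    trans (sym (chosen-top c N int rep)) (trans (same (domAt N top)) (chosen-top c′ N int rep))

  -- Every tiling T with arrows f is the chosen tiling of its own orientations
  -- (whether it contains the top domino) at the nodes.
  module Reconstruct (T : Tiling m) (follows : FollowsTiling n m T f) where

    t : Domino → Bool
    t = proj₁ T

    orientation : Point → Bool
    orientation N = t (domAt N top)

    t-within : ∀ D → t D ≡ true → DominoIn m D
    t-within = proj₁ (proj₂ T)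

    t-cover : ∀ s → InA m s → Σ Domino λ D → t D ≡ true × Covers D s
    t-cover = proj₁ (proj₂ (proj₂ T))

    t-disjoint : ∀ s D D′ → t D ≡ true → t D′ ≡ true → Covers D s → Covers D′ s → D ≡ D′
    t-disjoint = proj₂ (proj₂ (proj₂ T))

    t-at : ∀ D → t D ≡ true → t (domAt (nodeOf D) (pairOf D)) ≡ true
    t-at D e = subst (λ X → t X ≡ true) (domAt-node D) e

    t-inside : ∀ D → t D ≡ true → ∀ q → q ∈ₚ pairOf D → InA m (sqAt (nodeOf D) q)
    t-inside D e = in-domAt m (nodeOf D) (pairOf D) (subst (DominoIn m) (domAt-node D) (t-within D e))

    -- the arrows of a domino of T leave its node, since the node is not a corner
    t-outward : ∀ D → t D ≡ true → Outward D
    t-outward D e q q∈ with away n f (nodeOf D) q in out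
    ... | true  = refl
    ... | false = ⊥-elim (anchor-not-corner N pr (subst (λ h → IsCorner h (domAt N pr)) head≡N corner))
      where
        N = nodeOf D
        pr = pairOf D
        corner : IsCorner (head n (sqAt N q) (f (sqAt N q))) (domAt N pr)
        corner = follows (sqAt N q) (t-inside D e q q∈) (domAt N pr) (t-at D e) (covers-pair N pr q q∈)
        head≡N : head n (sqAt N q) (f (sqAt N q)) ≡ N
        head≡N = proj₁ (away-false n f q (anchor-node n D) out)

    t-through : ∀ N → InteriorNode n N → ∀ q → away n f N q ≡ true → Σ Pair λ pr → q ∈ₚ pr × t (domAt N pr) ≡ true
    t-through N int@((_ , par) , _) q out with t-cover (sqAt N q) (outward-inside N int q out)
    ... | D , e , cv = pairOf D , subst (_∈ₚ pairOf D) same-pos pos∈ , subst (λ X → t (domAt X (pairOf D)) ≡ true) same-node (t-at D e)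
      where
        open Leaves (leaves D (sqAt N q) (t-outward D e) cv)
        same-node : nodeOf D ≡ N
        same-node = trans (sym from) (proj₁ (away-true n f q par out))
        same-pos : pos ≡ q
        same-pos = sqAt-injective N pos q (trans (cong (λ X → sqAt X pos) (sym same-node)) (sym at))

    t-no-cross : ∀ N h v → nodeParity n N ≡ true → horizontal h ≡ true → horizontal v ≡ false →
                 t (domAt N h) ≡ true → t (domAt N v) ≡ true → ⊥
    t-no-cross N h v par hh vv eh ev with crossing h v hh vv
    ... | q , q∈h , q∈v = case trans (sym hh) (trans (cong horizontal h≡v) vv) of λ ()
      where
        h≡v : h ≡ v
        h≡v = cong proj₂ (trans (sym (anchor-domAt n N h par))
                (trans (cong (anchor n) (t-disjoint (sqAt N q) _ _ eh ev (covers-pair N h q q∈h) (covers-pair N v q q∈v)))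
                       (anchor-domAt n N v par)))

    top-free : ∀ N pr → nodeParity n N ≡ true → horizontal pr ≡ false → t (domAt N pr) ≡ true → orientation N ≡ false
    top-free N pr par vertical e with orientation N in o
    ... | false = refl
    ... | true  = ⊥-elim (t-no-cross N top pr par refl vertical o e)

    top-taken : ∀ N pr → InteriorNode n N → Repels n f N → horizontal pr ≡ true → t (domAt N pr) ≡ true →
                orientation N ≡ true
    top-taken N pr int rep horiz e with t-through N int NW (rep NW)
    ... | pr′ , NW∈ , e′ with pair-through NW pr′ NW∈
    ...   | inj₁ refl = e′
    ...   | inj₂ refl = ⊥-elim (t-no-cross N pr lft (proj₂ (proj₁ int)) horiz refl e e′)

    t-oriented : ∀ D → t D ≡ true → Repels n f (nodeOf D) → horizontal (pairOf D) ≡ orientation (nodeOf D)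
    t-oriented D e rep with horizontal (pairOf D) in h
    ... | true  = sym (top-taken (nodeOf D) (pairOf D) (outward-interior D (t-outward D e) (t-within D e)) rep h (t-at D e))
    ... | false = sym (top-free (nodeOf D) (pairOf D) (anchor-node n D) h (t-at D e))

    module _ (c : Point → Bool) (agrees : ∀ N → InteriorNode n N → Repels n f N → c N ≡ orientation N) where

      t-selected : ∀ D → t D ≡ true → Selected c (nodeOf D) (pairOf D)
      t-selected D e = record
        { inside   = t-inside D e
        ; outward  = t-outward D e
        ; oriented = λ rep → trans (t-oriented D e rep)
                               (sym (agrees (nodeOf D) (outward-interior D (t-outward D e) (t-within D e)) rep)) }

      t⇒chosen : ∀ D → t D ≡ true → chosen c D ≡ true
      t⇒chosen D e = dec-true (selected? c (nodeOf D) (pairOf D)) (t-selected D e)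

      -- a chosen domino meets a domino of T, which is chosen too, hence equal to it
      chosen⇒t : ∀ D → chosen c D ≡ true → t D ≡ true
      chosen⇒t D e with t-cover s (Selected.inside (chosen-selected c D e) (first (pairOf D)) (inj₁ refl))
        where s = sqAt (nodeOf D) (first (pairOf D))
      ... | D′ , e′ , cv′ = subst (λ X → t X ≡ true) (sym same) e′
        where
          cv : Covers D (sqAt (nodeOf D) (first (pairOf D)))
          cv = subst (λ X → Covers X (sqAt (nodeOf D) (first (pairOf D)))) (sym (domAt-node D))
                 (covers-pair (nodeOf D) (pairOf D) _ (inj₁ refl))
          same : D ≡ D′
          same = chosen-disjoint c _ D D′ e (t⇒chosen D′ e′) cv cv′

      reconstruct : chosen c ≗ t
      reconstruct D with t D in e
      ... | true  = t⇒chosen D e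
      ... | false with chosen c D in e′
      ...   | false = refl
      ...   | true  = case trans (sym (chosen⇒t D e′)) e of λ ()

  count : (L : List Point) → Unique L →
          (∀ N → N ∈ L → InteriorNode n N × Repels n f N) →
          (∀ N → InteriorNode n N → Repels n f N → N ∈ L) →
          CountIs m (λ T → FollowsTiling n m T f) (2 ^ length L)
  count L unique sound complete = chosen-tiling ∘ choice , chosen-follows ∘ choice , distinct , onto
    where
      open Choices L unique
      distinct : ∀ i j → chosen-tiling (choice i) ≈T chosen-tiling (choice j) → i ≡ j
      distinct i j same = choice-injective i j λ k →
        let (int , rep) = sound (List.lookup L k) (∈-lookup k)
        in chosen-injective (choice i) (choice j) same (List.lookup L k) int rep
      onto : ∀ T → FollowsTiling n m T f → Σ (Fin (2 ^ length L)) λ i → chosen-tiling (choice i) ≈T T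
      onto T follows with choice-onto (Reconstruct.orientation T follows)
      ... | i , agrees = i , Reconstruct.reconstruct T follows (choice i) (λ N int rep → agrees N (complete N int rep))

-- A lattice point (i , j) lies in A_m iff
-- (|i| ∸ 1) + (|j| ∸ 1) < m; in particular an interior node satisfies
-- |i| + |j| ≤ n, so its four squares lie in A_{n+1}.

-- distance from 0 to the nearer of the two unit intervals ending at i
near : ℤ → ℕ
near i = ∣ i ∣ ∸ 1

near≤dist : ∀ i → near i ≤ dist i
near≤dist (+ zero)  = z≤n
near≤dist (+ suc a) = ℕP.n≤1+n a
near≤dist -[1+ a ]  = ℕP.≤-refl

near≤dist-pred : ∀ i → near i ≤ dist (i - 1ℤ)
near≤dist-pred (+ zero)  = z≤n
near≤dist-pred (+ suc a) = ℕP.≤-refl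
near≤dist-pred -[1+ a ]  = ℕP.≤-trans (ℕP.n≤1+n a) (s≤s (ℕP.m≤m+n a 0))

near-attained : ∀ i → dist i ≡ near i ⊎ dist (i - 1ℤ) ≡ near i
near-attained (+ zero)  = inj₁ refl
near-attained (+ suc a) = inj₂ refl
near-attained -[1+ a ]  = inj₁ refl

dist≤∣∣ : ∀ i → dist i ≤ ∣ i ∣
dist≤∣∣ (+ a)    = ℕP.≤-refl
dist≤∣∣ -[1+ a ] = ℕP.n≤1+n a

dist-pred≤∣∣ : ∀ i → dist (i - 1ℤ) ≤ ∣ i ∣
dist-pred≤∣∣ (+ zero)  = z≤n
dist-pred≤∣∣ (+ suc a) = ℕP.n≤1+n a
dist-pred≤∣∣ -[1+ a ]  = s≤s (ℕP.≤-reflexive (ℕP.+-identityʳ a))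

pointIn⇒near : ∀ m i j → PointIn m (i , j) → near i ℕ.+ near j < m
pointIn⇒near m i j (inj₁ h)               = ℕP.≤-<-trans (ℕP.+-mono-≤ (near≤dist i) (near≤dist j)) h
pointIn⇒near m i j (inj₂ (inj₁ h))        = ℕP.≤-<-trans (ℕP.+-mono-≤ (near≤dist-pred i) (near≤dist j)) h
pointIn⇒near m i j (inj₂ (inj₂ (inj₁ h))) = ℕP.≤-<-trans (ℕP.+-mono-≤ (near≤dist i) (near≤dist-pred j)) h
pointIn⇒near m i j (inj₂ (inj₂ (inj₂ h))) = ℕP.≤-<-trans (ℕP.+-mono-≤ (near≤dist-pred i) (near≤dist-pred j)) h

near⇒pointIn : ∀ m i j → near i ℕ.+ near j < m → PointIn m (i , j)
near⇒pointIn m i j h with near-attained i | near-attained j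
... | inj₁ e₁ | inj₁ e₂ = inj₁ (subst (_< m) (sym (cong₂ ℕ._+_ e₁ e₂)) h)
... | inj₂ e₁ | inj₁ e₂ = inj₂ (inj₁ (subst (_< m) (sym (cong₂ ℕ._+_ e₁ e₂)) h))
... | inj₁ e₁ | inj₂ e₂ = inj₂ (inj₂ (inj₁ (subst (_< m) (sym (cong₂ ℕ._+_ e₁ e₂)) h)))
... | inj₂ e₁ | inj₂ e₂ = inj₂ (inj₂ (inj₂ (subst (_< m) (sym (cong₂ ℕ._+_ e₁ e₂)) h)))

corner-in : ∀ m N p → InA m (sqAt N p) → PointIn m N
corner-in m N NE h = inj₁ h
corner-in m N NW h = inj₂ (inj₁ h)
corner-in m N SE h = inj₂ (inj₂ (inj₁ h))
corner-in m N SW h = inj₂ (inj₂ (inj₂ h))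

parity-gap : ∀ a n → a < n → evenℕ a ≡ evenℕ n → suc (suc a) ≤ n
parity-gap a (suc k) (s≤s a≤k) same with ℕP.m≤n⇒m<n∨m≡n a≤k
... | inj₁ a<k  = s≤s a<k
... | inj₂ refl = ⊥-elim (not-¬ refl same)

near-sum : ∀ a b n → (a ∸ 1) ℕ.+ (b ∸ 1) < n → evenℕ (a ℕ.+ b) ≡ evenℕ n → a ℕ.+ b ≤ n
near-sum zero    zero    n _ _ = z≤n
near-sum zero    (suc b) n h _ = h
near-sum (suc a) zero    n h _ = h
near-sum (suc a) (suc b) n h same rewrite ℕP.+-suc a b =
  parity-gap (a ℕ.+ b) n h (trans (sym (not-involutive (evenℕ (a ℕ.+ b)))) same)

interior-norm : ∀ n i j → InteriorNode n (i , j) → ∣ i ∣ ℕ.+ ∣ j ∣ ≤ n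
interior-norm n i j ((_ , par) , inside) =
  near-sum ∣ i ∣ ∣ j ∣ n (pointIn⇒near n i j inside) (node-parity n i j par)

interior-squares : ∀ n N p → InteriorNode n N → InA (suc n) (sqAt N p)
interior-squares n (i , j) NE int = s≤s (ℕP.≤-trans (ℕP.+-mono-≤ (dist≤∣∣ i) (dist≤∣∣ j)) (interior-norm n i j int))
interior-squares n (i , j) NW int = s≤s (ℕP.≤-trans (ℕP.+-mono-≤ (dist-pred≤∣∣ i) (dist≤∣∣ j)) (interior-norm n i j int))
interior-squares n (i , j) SW int = s≤s (ℕP.≤-trans (ℕP.+-mono-≤ (dist-pred≤∣∣ i) (dist-pred≤∣∣ j)) (interior-norm n i j int))
interior-squares n (i , j) SE int = s≤s (ℕP.≤-trans (ℕP.+-mono-≤ (dist≤∣∣ i) (dist-pred≤∣∣ j)) (interior-norm n i j int))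

Straddle : ℤ → ℤ → ℕ → Set
Straddle x x′ d = (∣ x ∣ ≡ d × ∣ x′ ∣ ≡ suc d) ⊎ (∣ x ∣ ≡ suc d × ∣ x′ ∣ ≡ d)

straddle : ∀ k → Straddle k (k + 1ℤ) (dist k)
straddle (+ a)          = inj₁ (refl , ℕP.+-comm a 1)
straddle -[1+ zero ]    = inj₂ (refl , refl)
straddle -[1+ suc a ]   = inj₂ (refl , refl)

straddle-swap : ∀ {x x′ d} → Straddle x x′ d → Straddle x′ x d
straddle-swap (inj₁ (a , b)) = inj₂ (b , a)
straddle-swap (inj₂ (a , b)) = inj₁ (b , a)

near-drop : ∀ a b → 1 ≤ a ℕ.+ b → (a ∸ 1) ℕ.+ (b ∸ 1) < a ℕ.+ b
near-drop zero    (suc b) _ = ℕP.≤-refl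
near-drop (suc a) zero    _ = s≤s (ℕP.≤-reflexive refl)
near-drop (suc a) (suc b) _ = s≤s (ℕP.≤-trans (ℕP.n≤1+n (a ℕ.+ b)) (ℕP.≤-reflexive (sym (ℕP.+-suc a b))))

_⊻_ : Set → Set → Set
P ⊻ Q = (P × ¬ Q) ⊎ (¬ P × Q)

opposite-corners : ∀ n x x′ y y′ dk dl → Straddle x x′ dk → Straddle y y′ dl → dk ℕ.+ dl ≡ n → 1 ≤ n →
                   nodeParity n (x , y) ≡ true → nodeParity n (x′ , y′) ≡ true →
                   PointIn n (x , y) ⊻ PointIn n (x′ , y′)
opposite-corners n x x′ y y′ dk dl (inj₁ (x≡ , x′≡)) (inj₁ (y≡ , y′≡)) sum 1≤n _ _ =
  inj₁ (near⇒pointIn n x y inner , λ p → ℕP.<-irrefl refl (subst (_< n) outer (pointIn⇒near n x′ y′ p)))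
  where
    inner : near x ℕ.+ near y < n
    inner = subst₂ _<_ (sym (cong₂ (λ u v → (u ∸ 1) ℕ.+ (v ∸ 1)) x≡ y≡)) sum (near-drop dk dl (subst (1 ≤_) (sym sum) 1≤n))
    outer : near x′ ℕ.+ near y′ ≡ n
    outer rewrite x′≡ | y′≡ = sum
opposite-corners n x x′ y y′ dk dl (inj₂ (x≡ , x′≡)) (inj₂ (y≡ , y′≡)) sum 1≤n _ _ =
  inj₂ ((λ p → ℕP.<-irrefl refl (subst (_< n) outer (pointIn⇒near n x y p))) , near⇒pointIn n x′ y′ inner)
  where
    inner : near x′ ℕ.+ near y′ < n
    inner = subst₂ _<_ (sym (cong₂ (λ u v → (u ∸ 1) ℕ.+ (v ∸ 1)) x′≡ y′≡)) sum (near-drop dk dl (subst (1 ≤_) (sym sum) 1≤n))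
    outer : near x ℕ.+ near y ≡ n
    outer rewrite x≡ | y≡ = sum
opposite-corners n x x′ y y′ dk dl (inj₁ (x≡ , _)) (inj₂ (y≡ , _)) sum _ par _ =
  ⊥-elim (not-¬ refl (sym (trans (cong evenℕ (sym norm)) (node-parity n x y par))))
  where norm : ∣ x ∣ ℕ.+ ∣ y ∣ ≡ suc n
        norm = trans (cong₂ ℕ._+_ x≡ y≡) (trans (ℕP.+-suc dk dl) (cong suc sum))
opposite-corners n x x′ y y′ dk dl (inj₂ (x≡ , _)) (inj₁ (y≡ , _)) sum _ par _ =
  ⊥-elim (not-¬ refl (sym (trans (cong evenℕ (sym norm)) (node-parity n x y par))))
  where norm : ∣ x ∣ ℕ.+ ∣ y ∣ ≡ suc n
        norm = trans (cong₂ ℕ._+_ x≡ y≡) (cong suc sum)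

boundary-nodes : ∀ n s → 1 ≤ n → BoundarySq n s → PointIn n (upperNode n s) ⊻ PointIn n (lowerNode n s)
boundary-nodes n (k , l) 1≤n (s≤s in₁ , ∉₀) with nodeParity n (k , l) | corner-nodes n (k , l)
... | true  | up , lo = opposite-corners n (k + 1ℤ) k (l + 1ℤ) l (dist k) (dist l)
                         (straddle-swap {k} {k + 1ℤ} (straddle k)) (straddle-swap {l} {l + 1ℤ} (straddle l)) sum 1≤n up lo
  where sum = ℕP.≤-antisym in₁ (ℕP.≮⇒≥ ∉₀)
... | false | up , lo = opposite-corners n k (k + 1ℤ) (l + 1ℤ) l (dist k) (dist l)
                         (straddle k) (straddle-swap {l} {l + 1ℤ} (straddle l)) sum 1≤n up lo
  where sum = ℕP.≤-antisym in₁ (ℕP.≮⇒≥ ∉₀)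

boundary-arrow : ∀ n s b → 1 ≤ n → BoundarySq n s → PointIn n (head n s b) ⊻ PointIn n (tail n s b)
boundary-arrow n s true  1≤n bd = boundary-nodes n s 1≤n bd
boundary-arrow n s false 1≤n bd with boundary-nodes n s 1≤n bd
... | inj₁ (up , ¬lo) = inj₂ (¬lo , up)
... | inj₂ (¬up , lo) = inj₁ (lo , ¬up)

module _ (n : ℕ) (f : Arrows) where

  tail-in : ∀ m s → InA m s → PointIn m (tail n s (f s))
  tail-in m s s∈ with square-of-tail n f s
  ... | q , at , _ = corner-in m _ q (subst (InA m) (sym at) s∈)

  tail-interior-inward : ∀ s → InA n s → InteriorNode n (tail n s (f s))
  tail-interior-inward s s∈ = (tail-in (suc n) s (ℕP.m<n⇒m<1+n s∈) , tail-node n s (f s)) , tail-in n s s∈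

  outward-inside-inward : 1 ≤ n → InwardPointing n f →
                          ∀ N → InteriorNode n N → ∀ p → away n f N p ≡ true → InA n (sqAt N p)
  outward-inside-inward 1≤n inward N int p out with InA? n (sqAt N p)
  ... | yes s∈ = s∈
  ... | no  s∉ with boundary-arrow n (sqAt N p) (f (sqAt N p)) 1≤n (interior-squares n N p int , s∉)
  ...   | inj₁ (_ , tail∉) = ⊥-elim (tail∉ (subst (PointIn n) (sym (proj₁ (away-true n f p (proj₂ (proj₁ int)) out))) (proj₂ int)))
  ...   | inj₂ (head∉ , _) = ⊥-elim (head∉ (inward (sqAt N p) (interior-squares n N p int , s∉)))

  tail-interior-outward : 1 ≤ n → OutwardPointing n f → ∀ s → InA (suc n) s → InteriorNode n (tail n s (f s))
  tail-interior-outward 1≤n outward s s∈ = (tail-in (suc n) s s∈ , tail-node n s (f s)) , in-Aₙ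
    where
      in-Aₙ : PointIn n (tail n s (f s))
      in-Aₙ with InA? n s
      ... | yes s∈ₙ = tail-in n s s∈ₙ
      ... | no  s∉ₙ with boundary-arrow n s (f s) 1≤n (s∈ , s∉ₙ)
      ...   | inj₁ (head∈ , _) = ⊥-elim (outward s (s∈ , s∉ₙ) head∈)
      ...   | inj₂ (_ , tail∈) = tail∈

range-complete : ∀ M i → ∣ i ∣ ≤ M → i ∈ range M
range-complete M (+ b) h = subst (_∈ range M) eq (∈-applyUpTo⁺ (λ a → + a - + M) (s≤s (ℕP.+-monoˡ-≤ M h)))
  where eq : + (b ℕ.+ M) - + M ≡ + b
        eq = solve 2 (λ x y → x :+ y :- y := x) refl (+ b) (+ M)
range-complete M -[1+ b ] h = subst (_∈ range M) eq (∈-applyUpTo⁺ (λ a → + a - + M) lt)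
  where
    lt : M ∸ suc b < suc (M ℕ.+ M)
    lt = s≤s (ℕP.≤-trans (ℕP.m∸n≤m M (suc b)) (ℕP.m≤m+n M M))
    eq : + (M ∸ suc b) - + M ≡ -[1+ b ]
    eq = begin
      + (M ∸ suc b) - + M         ≡⟨ cong (_- + M) (trans (sym (ℤP.⊖-≥ h)) (sym (ℤP.[+m]-[+n]≡m⊖n M (suc b)))) ⟩
      + M - + suc b - + M         ≡⟨ solve 2 (λ x y → x :- y :- x := :- y) refl (+ M) (+ suc b) ⟩
      -[1+ b ]                    ∎
      where open ≡-Reasoning

range-unique : ∀ M → Unique (range M)
range-unique M = applyUpTo⁺₁ (λ a → + a - + M) (suc (M ℕ.+ M))
  (λ i<j _ eq → ℕP.<⇒≢ i<j (ℤP.+-injective (∙-cancelʳ (- + M) _ _ eq)))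

grid-complete : ∀ n N → InteriorNode n N → N ∈ grid (suc n)
grid-complete n (i , j) int = ∈-cartesianProduct⁺ (range-complete (suc n) i i≤) (range-complete (suc n) j j≤)
  where
    i≤ = ℕP.m≤n⇒m≤1+n (ℕP.≤-trans (ℕP.m≤m+n ∣ i ∣ ∣ j ∣) (interior-norm n i j int))
    j≤ = ℕP.m≤n⇒m≤1+n (ℕP.≤-trans (ℕP.m≤n+m ∣ j ∣ ∣ i ∣) (interior-norm n i j int))

grid-unique : ∀ M → Unique (grid M)
grid-unique M = cartesianProduct⁺ (range-unique M) (range-unique M)

count-cong : ∀ {m k} {P Q : Tiling m → Set} → (∀ T → P T → Q T) → (∀ T → Q T → P T) → CountIs m P k → CountIs m Q k
count-cong P⇒Q Q⇒P (tiling , holds , distinct , onto) =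
  tiling , (λ i → P⇒Q (tiling i) (holds i)) , distinct , λ T q → onto T (Q⇒P T q)

lemma1 : (n : ℕ) → 1 ≤ n → (f : Arrows) → IsField n f →
    (InwardPointing n f → CountIs n (λ T → F-small≡ n T f) (2 ^ repellingCount n f)) ×
    (OutwardPointing n f → CountIs (suc n) (λ T → F-big≡ n T f) (2 ^ repellingCount n f))
lemma1 n 1≤n f isField = part-i , part-ii
  where
    repelling? = λ N → InteriorNode? n N ×-dec Repelling? n f N
    L = filter repelling? (grid (suc n))

    unique : Unique L
    unique = unique-filter⁺ repelling? (grid-unique (suc n))

    sound : ∀ N → N ∈ L → InteriorNode n N × Repels n f N
    sound N N∈ = let (int , rep) = proj₂ (∈-filter⁻ repelling? {xs = grid (suc n)} N∈)
                 in int , repelling⇒repels n f N (proj₂ (proj₁ int)) rep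

    complete : ∀ N → InteriorNode n N → Repels n f N → N ∈ L
    complete N int rep = ∈-filter⁺ repelling? (grid-complete n N int) (int , repels⇒repelling n f N (proj₂ (proj₁ int)) rep)

    part-i : InwardPointing n f → CountIs n (λ T → F-small≡ n T f) (2 ^ repellingCount n f)
    part-i inward = count-cong (λ _ follows → follows , inward) (λ _ → proj₁)
      (Construction.count n n f isField (tail-interior-inward n f) (outward-inside-inward n f 1≤n inward)
                          L unique sound complete)

    part-ii : OutwardPointing n f → CountIs (suc n) (λ T → F-big≡ n T f) (2 ^ repellingCount n f)
    part-ii outward = Construction.count n (suc n) f isField (tail-interior-outward n f 1≤n outward)
                        (λ N int p _ → interior-squares n N p int) L unique sound complete
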